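{- For every integer $n\ge 0$, there is a bijection between the set of doubly rooted plane trees with $n$ edges and the set of free Dyck paths of length $2n$.
   Context: A plane tree is a rooted tree in which the children of each vertex are linearly ordered (left to right). A doubly rooted plane tree is a plane tree together with a distinguished vertex (any vertex, possibly the root). A free Dyck path of length $2n$ is a lattice path from $(0,0)$ to $(2n,0)$ consisting of $n$ up steps $(1,1)$ and $n$ down steps $(1,-1)$, with no further restriction. -}

module Defs where

open import Data.Nat using (ℕ; zero; suc; _+_; _*_)
open import Data.List using (List; []; _∷_)
open import Data.Vec using (Vec; []; _∷_)
open import Data.Product using (Σ; _×_)
open import Data.List.Relation.Unary.Any using (Any)
open import Relation.Binary.PropositionalEquality using (_≡_)

data PlaneTree : Set where
  node : List PlaneTree → PlaneTree

mutual
  edges : PlaneTree → ℕ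
  edges (node ts) = edgesF ts

  -- each child contributes one edge (to its parent) plus its own edges
  edgesF : List PlaneTree → ℕ
  edgesF [] = 0
  edgesF (t ∷ ts) = suc (edges t + edgesF ts)

data Vertex : PlaneTree → Set where
  root  : ∀ {ts} → Vertex (node ts)
  below : ∀ {ts} → Any Vertex ts → Vertex (node ts)

-- Doubly rooted plane trees with n edges: a plane tree with n edges together
-- with a distinguished vertex (any vertex, possibly the root).
DoublyRootedPlaneTree : ℕ → Set
DoublyRootedPlaneTree n = Σ PlaneTree (λ t → edges t ≡ n × Vertex t)

data Step : Set where
  U D : Step   -- U = (1,1), D = (1,-1)

countU : ∀ {m} → Vec Step m → ℕ
countU [] = 0
countU (U ∷ s) = suc (countU s)
countU (D ∷ s) = countU s

-- Free Dyck paths of length 2n: step sequences of length 2n with exactly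
-- n up steps (hence exactly n down steps, ending at height 0); no other restriction.
FreeDyckPath : ℕ → Set
FreeDyckPath n = Σ (Vec Step (2 * n)) (λ s → countU s ≡ n)

-- A doubly rooted tree is a zipper: the forest C below the marked vertex, and for every edge on
-- the path from the root down to it the forests L and R of its left and right siblings. Listing the
-- trees of C, then for each path edge the forest L followed by the trees of R, turns it into a
-- sequence of pieces, each a tree or a forest. A tree with children F is written as the positive
-- excursion U w D, a forest F as the negative excursion D w̄ U, where w is the Dyck word of F and w̄
-- its mirror image. Every free Dyck path factors uniquely into such primitive excursions, and in
-- every step the number of edges equals the semilength.

module Submission where

open import Defs
open import Data.Bool using (Bool; true; false)
open import Data.Empty using (⊥-elim)
open import Data.List using (List; []; _∷_; _++_; length; foldr)
open import Data.List.Properties using (++-assoc; ++-identityʳ; foldr-++)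
open import Data.List.Relation.Unary.Any using (Any; here; there)
open import Data.List.Relation.Unary.Any.Properties using (++⁺ʳ)
open import Data.Nat using (ℕ; suc; _+_; _*_)
open import Data.Nat.Properties using (≡-irrelevant; +-assoc; +-suc; +-identityʳ; +-cancelˡ-≡; m+1+n≢m)
open import Data.Nat.Tactic.RingSolver using (solve-∀)
open import Data.Product using (Σ; _×_; _,_; proj₁; proj₂; map₁; uncurry)
import Data.Product as Product
open import Data.Product.Algebra using (Σ-assoc; ×-comm)
open import Data.Product.Function.Dependent.Propositional using (Σ-↔)
open import Data.Sum using (_⊎_; inj₁; inj₂)
open import Data.Vec using (Vec; toList; fromList; cast)
open import Data.Vec.Properties using (length-toList; toList-cast; toList∘fromList; fromList∘toList)
open import Function.Bundles using (_⤖_; _↔_; mk↔ₛ′; Inverse)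
open import Function.Properties.Inverse using (↔-refl; ↔⇒⤖)
import Function.Related.Propositional as Related
open import Relation.Binary.PropositionalEquality
open import Relation.Nullary using (Irrelevant)

Σ-≡-irrelevant : ∀ {A : Set} {P : A → Set} → (∀ {a} → Irrelevant (P a)) →
                 {x y : Σ A P} → proj₁ x ≡ proj₁ y → x ≡ y
Σ-≡-irrelevant irr {a , p} {.a , q} refl = cong (a ,_) (irr p q)

≡-cong-↔ : ∀ {a b n : ℕ} → a ≡ b → (a ≡ n) ↔ (b ≡ n)
≡-cong-↔ refl = ↔-refl

Σ-weight-↔ : ∀ {A B : Set} {n} (i : A ↔ B) (wA : A → ℕ) (wB : B → ℕ) →
             (∀ a → wB (Inverse.to i a) ≡ wA a) →
             Σ A (λ a → wA a ≡ n) ↔ Σ B (λ b → wB b ≡ n)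
Σ-weight-↔ i wA wB w = Σ-↔ i (≡-cong-↔ (sym (w _)))

Vec↔List : ∀ {A : Set} {m} → Vec A m ↔ Σ (List A) (λ xs → length xs ≡ m)
Vec↔List = mk↔ₛ′ (λ v → toList v , length-toList v) (λ (xs , p) → cast p (fromList xs))
  (λ (xs , p) → Σ-≡-irrelevant ≡-irrelevant (trans (toList-cast p (fromList xs)) (toList∘fromList xs)))
  fromList∘toList

-- A list over A ⊎ B splits into an initial run of A's and the B's, each followed by its run of A's.

module _ {A B : Set} where

  join : List A → List (B × List A) → List (A ⊎ B)
  join (a ∷ as) bas = inj₁ a ∷ join as bas
  join [] [] = []
  join [] ((b , as) ∷ bas) = inj₂ b ∷ join as bas

  newRun : B → List A × List (B × List A) → List A × List (B × List A)
  newRun b (as , bas) = [] , (b , as) ∷ bas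

  split : List (A ⊎ B) → List A × List (B × List A)
  split [] = [] , []
  split (inj₁ a ∷ xs) = map₁ (a ∷_) (split xs)
  split (inj₂ b ∷ xs) = newRun b (split xs)

  join-split : ∀ xs → uncurry join (split xs) ≡ xs
  join-split [] = refl
  join-split (inj₁ a ∷ xs) = cong (inj₁ a ∷_) (join-split xs)
  join-split (inj₂ b ∷ xs) = cong (inj₂ b ∷_) (join-split xs)

  split-join : ∀ as bas → split (join as bas) ≡ (as , bas)
  split-join (a ∷ as) bas = cong (map₁ (a ∷_)) (split-join as bas)
  split-join [] [] = refl
  split-join [] ((b , as) ∷ bas) = cong (newRun b) (split-join as bas)

  runs↔List-⊎ : (List A × List (B × List A)) ↔ List (A ⊎ B)
  runs↔List-⊎ = mk↔ₛ′ (uncurry join) split join-split (uncurry split-join)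

Forest : Set
Forest = List PlaneTree

Frame : Set
Frame = Forest × Forest

Zipper : Set
Zipper = Forest × List Frame

PointedTree : Set
PointedTree = Σ PlaneTree Vertex

insert : Frame → PointedTree → Σ Forest (Any Vertex)
insert (L , R) (t , v) = L ++ t ∷ R , ++⁺ʳ L (here v)

enter : Σ Forest (Any Vertex) → PointedTree
enter (ts , a) = node ts , below a

plug : Zipper → PointedTree
plug (C , []) = node C , root
plug (C , f ∷ fs) = enter (insert f (plug (C , fs)))

addFrame : Frame × Zipper → Zipper
addFrame (f , (C , fs)) = C , f ∷ fs

mutual
  focus : (t : PlaneTree) → Vertex t → Zipper
  focus (node ts) root = ts , []
  focus (node ts) (below a) = addFrame (focusAny a)

  focusAny : ∀ {ts} → Any Vertex ts → Frame × Zipper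
  focusAny (here {x} {xs} v) = ([] , xs) , focus x v
  focusAny (there {x} a) = map₁ (map₁ (x ∷_)) (focusAny a)

focusAny-insert : ∀ (L R : Forest) {t} (v : Vertex t) →
                  focusAny (++⁺ʳ L (here {xs = R} v)) ≡ ((L , R) , focus t v)
focusAny-insert [] R v = refl
focusAny-insert (x ∷ L) R v = cong (map₁ (map₁ (x ∷_))) (focusAny-insert L R v)

focus-plug : ∀ z → uncurry focus (plug z) ≡ z
focus-plug (C , []) = refl
focus-plug (C , (L , R) ∷ fs) =
  trans (cong addFrame (focusAny-insert L R (proj₂ (plug (C , fs)))))
        (cong (λ z → addFrame ((L , R) , z)) (focus-plug (C , fs)))

mutual
  plug-focus : ∀ t (v : Vertex t) → plug (focus t v) ≡ (t , v)
  plug-focus (node ts) root = refl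
  plug-focus (node ts) (below a) = cong enter (insert-focusAny a)

  insert-focusAny : ∀ {ts} (a : Any Vertex ts) →
                    insert (proj₁ (focusAny a)) (plug (proj₂ (focusAny a))) ≡ (ts , a)
  insert-focusAny (here {x} {xs} v) = cong (insert ([] , xs)) (plug-focus x v)
  insert-focusAny (there {x} a) = cong (Product.map (x ∷_) there) (insert-focusAny a)

zipper↔pointed : Zipper ↔ PointedTree
zipper↔pointed = mk↔ₛ′ plug (uncurry focus) (uncurry plug-focus) focus-plug

edgesF-++ : ∀ (L : Forest) {R} → edgesF (L ++ R) ≡ edgesF L + edgesF R
edgesF-++ [] = refl
edgesF-++ (t ∷ L) {R} = cong suc (trans (cong (edges t +_) (edgesF-++ L)) (sym (+-assoc (edges t) _ _)))

contextEdges : List Frame → ℕ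
contextEdges [] = 0
contextEdges ((L , R) ∷ fs) = suc (edgesF L + (edgesF R + contextEdges fs))

zipperEdges : Zipper → ℕ
zipperEdges (C , fs) = edgesF C + contextEdges fs

edges-plug : ∀ z → edges (proj₁ (plug z)) ≡ zipperEdges z
edges-plug (C , []) = sym (+-identityʳ _)
edges-plug (C , (L , R) ∷ fs) = begin
  edgesF (L ++ t ∷ R)                               ≡⟨ edgesF-++ L ⟩
  edgesF L + suc (edges t + edgesF R)               ≡⟨ cong (λ e → edgesF L + suc (e + edgesF R)) (edges-plug (C , fs)) ⟩
  edgesF L + suc (edgesF C + contextEdges fs + edgesF R) ≡⟨ rearrange (edgesF L) (edgesF R) (edgesF C) (contextEdges fs) ⟩
  edgesF C + contextEdges ((L , R) ∷ fs)            ∎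
  where
  open ≡-Reasoning
  t = proj₁ (plug (C , fs))
  rearrange : ∀ l r c k → l + suc (c + k + r) ≡ c + suc (l + (r + k))
  rearrange = solve-∀

δ : Step → Step → ℕ
δ U U = 1
δ U D = 0
δ D U = 0
δ D D = 1

occ : Step → List Step → ℕ
occ s [] = 0
occ s (x ∷ w) = δ s x + occ s w

occ-++ : ∀ s xs ys → occ s (xs ++ ys) ≡ occ s xs + occ s ys
occ-++ s [] ys = refl
occ-++ s (x ∷ xs) ys = trans (cong (δ s x +_) (occ-++ s xs ys)) (sym (+-assoc (δ s x) _ _))

length-occ : ∀ w → length w ≡ occ U w + occ D w
length-occ [] = refl
length-occ (U ∷ w) = cong suc (length-occ w)
length-occ (D ∷ w) = trans (cong suc (length-occ w)) (sym (+-suc (occ U w) (occ D w)))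

occ-toList : ∀ {m} (v : Vec Step m) → occ U (toList v) ≡ countU v
occ-toList Vec.[] = refl
occ-toList (U Vec.∷ v) = cong suc (occ-toList v)
occ-toList (D Vec.∷ v) = occ-toList v

Balanced : List Step → Set
Balanced w = occ U w ≡ occ D w

FreeWord : ℕ → Set
FreeWord n = Σ (List Step) (λ w → length w ≡ 2 * n × occ U w ≡ n)

freeWord-balanced : ∀ {n} w → length w ≡ 2 * n → occ U w ≡ n → Balanced w
freeWord-balanced {n} w l c = trans c (sym (trans occD≡n+0 (+-identityʳ n)))
  where
  occD≡n+0 : occ D w ≡ n + 0
  occD≡n+0 = +-cancelˡ-≡ n (occ D w) (n + 0) (trans (cong (_+ occ D w) (sym c)) (trans (sym (length-occ w)) l))

freeDyckPath↔freeWord : ∀ n → FreeDyckPath n ↔ FreeWord n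
freeDyckPath↔freeWord n = begin
  FreeDyckPath n                                             ↔⟨ Σ-↔ Vec↔List (λ {v} → ≡-cong-↔ (sym (occ-toList v))) ⟩
  Σ (Σ (List Step) (λ w → length w ≡ 2 * n)) (λ p → occ U (proj₁ p) ≡ n) ↔⟨ Σ-assoc ⟩
  FreeWord n                                                 ∎
  where open Related.EquationalReasoning

-- Orientation b = false mirrors a word: it turns excursions above the axis into excursions below.

up dn : Bool → Step
up true = U
up false = D
dn true = D
dn false = U

dyck : Bool → Forest → List Step
dyck b [] = []
dyck b (node ts ∷ F) = up b ∷ dyck b ts ++ dn b ∷ dyck b F

occ-wrap : ∀ s b w ys → occ s (up b ∷ w ++ dn b ∷ ys) ≡ suc (occ s w + occ s ys)
occ-wrap s b w ys rewrite occ-++ s w (dn b ∷ ys) = wrap s b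
  where
  wrap : ∀ s b → δ s (up b) + (occ s w + (δ s (dn b) + occ s ys)) ≡ suc (occ s w + occ s ys)
  wrap U true = refl
  wrap U false = +-suc (occ U w) (occ U ys)
  wrap D true = +-suc (occ D w) (occ D ys)
  wrap D false = refl

occ-dyck : ∀ s b F → occ s (dyck b F) ≡ edgesF F
occ-dyck s b [] = refl
occ-dyck s b (node ts ∷ F) =
  trans (occ-wrap s b (dyck b ts) (dyck b F)) (cong suc (cong₂ _+_ (occ-dyck s b ts) (occ-dyck s b F)))

Piece : Set
Piece = PlaneTree ⊎ Forest

piece : Bool → Forest → Piece
piece true F = inj₁ (node F)
piece false F = inj₂ F

encode : List Piece → List Step
encode [] = []
encode (inj₁ (node F) ∷ g) = U ∷ dyck true F ++ D ∷ encode g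
encode (inj₂ F ∷ g) = D ∷ dyck false F ++ U ∷ encode g

size : List Piece → ℕ
size [] = 0
size (inj₁ t ∷ g) = suc (edges t + size g)
size (inj₂ F ∷ g) = suc (edgesF F + size g)

occ-encode : ∀ s g → occ s (encode g) ≡ size g
occ-encode s [] = refl
occ-encode s (inj₁ (node F) ∷ g) =
  trans (occ-wrap s true (dyck true F) (encode g)) (cong suc (cong₂ _+_ (occ-dyck s true F) (occ-encode s g)))
occ-encode s (inj₂ F ∷ g) =
  trans (occ-wrap s false (dyck false F) (encode g)) (cong suc (cong₂ _+_ (occ-dyck s false F) (occ-encode s g)))

length-encode : ∀ g → length (encode g) ≡ 2 * size g
length-encode g = trans (length-occ (encode g))
  (trans (cong₂ _+_ (occ-encode U g) (occ-encode D g)) (cong (size g +_) (sym (+-identityʳ (size g)))))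

size-join : ∀ C fs → size (join C fs) ≡ zipperEdges (C , fs)
size-join (t ∷ C) fs = cong suc (trans (cong (edges t +_) (size-join C fs)) (sym (+-assoc (edges t) _ _)))
size-join [] [] = refl
size-join [] ((L , R) ∷ fs) = cong (λ k → suc (edgesF L + k)) (size-join R fs)

-- Reading a word from the right, pending b F Fs records the steps dn b not yet matched by an up b,
-- together with the forests between them.
data Stack : Set where
  closed  : Stack
  pending : Bool → Forest → List Forest → Stack

State : Set
State = List Piece × Stack

pendingWord : Bool → List Forest → List Step → List Step
pendingWord b [] w = w
pendingWord b (F ∷ Fs) w = dyck b F ++ dn b ∷ pendingWord b Fs w

unparse : State → List Step
unparse (g , closed) = encode g
unparse (g , pending b F Fs) = pendingWord b (F ∷ Fs) (encode g)

prepend : Step → State → State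
prepend D (g , closed) = g , pending true [] []
prepend U (g , closed) = g , pending false [] []
prepend D (g , pending true F Fs) = g , pending true [] (F ∷ Fs)
prepend U (g , pending false F Fs) = g , pending false [] (F ∷ Fs)
prepend U (g , pending true F []) = inj₁ (node F) ∷ g , closed
prepend D (g , pending false F []) = inj₂ F ∷ g , closed
prepend U (g , pending true F (F′ ∷ Fs)) = g , pending true (node F ∷ F′) Fs
prepend D (g , pending false F (F′ ∷ Fs)) = g , pending false (node F ∷ F′) Fs

parse : List Step → State
parse = foldr prepend ([] , closed)

unparse-prepend : ∀ x st → unparse (prepend x st) ≡ x ∷ unparse st
unparse-prepend D (g , closed) = refl
unparse-prepend U (g , closed) = refl
unparse-prepend D (g , pending true F Fs) = refl
unparse-prepend U (g , pending false F Fs) = refl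
unparse-prepend U (g , pending true F []) = refl
unparse-prepend D (g , pending false F []) = refl
unparse-prepend U (g , pending true F (F′ ∷ Fs)) =
  cong (U ∷_) (++-assoc (dyck true F) (D ∷ dyck true F′) (D ∷ pendingWord true Fs (encode g)))
unparse-prepend D (g , pending false F (F′ ∷ Fs)) =
  cong (D ∷_) (++-assoc (dyck false F) (U ∷ dyck false F′) (U ∷ pendingWord false Fs (encode g)))

unparse-parse : ∀ w → unparse (parse w) ≡ w
unparse-parse [] = refl
unparse-parse (x ∷ w) = trans (unparse-prepend x (parse w)) (cong (x ∷_) (unparse-parse w))

prepend-dn-closed : ∀ b g → prepend (dn b) (g , closed) ≡ (g , pending b [] [])
prepend-dn-closed true g = refl
prepend-dn-closed false g = refl

prepend-dn : ∀ b g F Fs → prepend (dn b) (g , pending b F Fs) ≡ (g , pending b [] (F ∷ Fs))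
prepend-dn true g F Fs = refl
prepend-dn false g F Fs = refl

prepend-up-last : ∀ b g F → prepend (up b) (g , pending b F []) ≡ (piece b F ∷ g , closed)
prepend-up-last true g F = refl
prepend-up-last false g F = refl

prepend-up : ∀ b g F F′ Fs → prepend (up b) (g , pending b F (F′ ∷ Fs)) ≡ (g , pending b (node F ∷ F′) Fs)
prepend-up true g F F′ Fs = refl
prepend-up false g F F′ Fs = refl

module _ (b : Bool) (g : List Piece) where

  mutual
    foldr-dyck : ∀ F F′ Fs → foldr prepend (g , pending b F′ Fs) (dyck b F) ≡ (g , pending b (F ++ F′) Fs)
    foldr-dyck [] F′ Fs = refl
    foldr-dyck (node ts ∷ F) F′ Fs =
      trans (cong (prepend (up b))
                  (foldr-level ts (dyck b F)
                     (trans (cong (prepend (dn b)) (foldr-dyck F F′ Fs)) (prepend-dn b g (F ++ F′) Fs))))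
            (prepend-up b g ts (F ++ F′) Fs)

    foldr-level : ∀ F {s} w {Fs} → prepend (dn b) (foldr prepend s w) ≡ (g , pending b [] Fs) →
                  foldr prepend s (dyck b F ++ dn b ∷ w) ≡ (g , pending b F Fs)
    foldr-level F {s} w {Fs} eq = begin
      foldr prepend s (dyck b F ++ dn b ∷ w)                          ≡⟨ foldr-++ prepend s (dyck b F) (dn b ∷ w) ⟩
      foldr prepend (prepend (dn b) (foldr prepend s w)) (dyck b F)   ≡⟨ cong (λ st → foldr prepend st (dyck b F)) eq ⟩
      foldr prepend (g , pending b [] Fs) (dyck b F)                  ≡⟨ foldr-dyck F [] Fs ⟩
      g , pending b (F ++ []) Fs                                      ≡⟨ cong (λ F′ → g , pending b F′ Fs) (++-identityʳ F) ⟩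
      g , pending b F Fs                                              ∎
      where open ≡-Reasoning

parse-piece : ∀ b F {g} → parse (encode g) ≡ (g , closed) →
              parse (up b ∷ dyck b F ++ dn b ∷ encode g) ≡ (piece b F ∷ g , closed)
parse-piece b F {g} parse-g =
  trans (cong (prepend (up b))
              (foldr-level b g F (encode g) (trans (cong (prepend (dn b)) parse-g) (prepend-dn-closed b g))))
        (prepend-up-last b g F)

parse-encode : ∀ g → parse (encode g) ≡ (g , closed)
parse-encode [] = refl
parse-encode (inj₁ (node F) ∷ g) = parse-piece true F (parse-encode g)
parse-encode (inj₂ F ∷ g) = parse-piece false F (parse-encode g)

occ-level : ∀ s b F x w → occ s (dyck b F ++ x ∷ w) ≡ edgesF F + (δ s x + occ s w)
occ-level s b F x w = trans (occ-++ s (dyck b F) (x ∷ w)) (cong (_+ occ s (x ∷ w)) (occ-dyck s b F))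

δ-dn-dn : ∀ b → δ (dn b) (dn b) ≡ 1
δ-dn-dn true = refl
δ-dn-dn false = refl

δ-up-dn : ∀ b → δ (up b) (dn b) ≡ 0
δ-up-dn true = refl
δ-up-dn false = refl

occ-pending : ∀ b Fs g → occ (dn b) (pendingWord b Fs (encode g)) ≡ occ (up b) (pendingWord b Fs (encode g)) + length Fs
occ-pending b [] g = trans (occ-encode (dn b) g) (sym (trans (+-identityʳ _) (occ-encode (up b) g)))
occ-pending b (F ∷ Fs) g = begin
  occ (dn b) (dyck b F ++ dn b ∷ P)                          ≡⟨ occ-level (dn b) b F (dn b) P ⟩
  edgesF F + (δ (dn b) (dn b) + occ (dn b) P)                 ≡⟨ cong₂ (λ d o → edgesF F + (d + o)) (δ-dn-dn b) (occ-pending b Fs g) ⟩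
  edgesF F + suc (occ (up b) P + length Fs)                   ≡⟨ rearrange (edgesF F) (occ (up b) P) (length Fs) ⟩
  edgesF F + (0 + occ (up b) P) + suc (length Fs)             ≡⟨ cong (λ d → edgesF F + (d + occ (up b) P) + suc (length Fs)) (sym (δ-up-dn b)) ⟩
  edgesF F + (δ (up b) (dn b) + occ (up b) P) + suc (length Fs) ≡⟨ cong (_+ suc (length Fs)) (sym (occ-level (up b) b F (dn b) P)) ⟩
  occ (up b) (dyck b F ++ dn b ∷ P) + suc (length Fs)        ∎
  where
  open ≡-Reasoning
  P = pendingWord b Fs (encode g)
  rearrange : ∀ e o k → e + suc (o + k) ≡ e + (0 + o) + suc k
  rearrange = solve-∀

balanced-orient : ∀ b w → Balanced w → occ (up b) w ≡ occ (dn b) w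
balanced-orient true w bal = bal
balanced-orient false w bal = sym bal

stack-closed : ∀ g st → Balanced (unparse (g , st)) → st ≡ closed
stack-closed g closed _ = refl
stack-closed g (pending b F Fs) bal =
  ⊥-elim (m+1+n≢m (occ (up b) w) (sym (trans (balanced-orient b w bal) (occ-pending b (F ∷ Fs) g))))
  where w = unparse (g , pending b F Fs)

encode-parse : ∀ w → Balanced w → encode (proj₁ (parse w)) ≡ w
encode-parse w bal with parse w | unparse-parse w
... | g , st | unparse≡w with stack-closed g st (subst Balanced (sym unparse≡w) bal)
... | refl = unparse≡w

pieces↔freeWord : ∀ n → Σ (List Piece) (λ g → size g ≡ n) ↔ FreeWord n
pieces↔freeWord n = mk↔ₛ′ toWord fromWord
  (λ (w , l , c) → Σ-≡-irrelevant ×-≡-irrelevant (encode-parse w (freeWord-balanced w l c)))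
  (λ (g , p) → Σ-≡-irrelevant ≡-irrelevant (cong proj₁ (parse-encode g)))
  where
  ×-≡-irrelevant : ∀ {k l m n : ℕ} → Irrelevant (k ≡ l × m ≡ n)
  ×-≡-irrelevant (p , q) (p′ , q′) = cong₂ _,_ (≡-irrelevant p p′) (≡-irrelevant q q′)

  toWord : Σ (List Piece) (λ g → size g ≡ n) → FreeWord n
  toWord (g , p) = encode g , trans (length-encode g) (cong (2 *_) p) , trans (occ-encode U g) p

  fromWord : FreeWord n → Σ (List Piece) (λ g → size g ≡ n)
  fromWord (w , l , c) = proj₁ (parse w) ,
    trans (sym (occ-encode U (proj₁ (parse w)))) (trans (cong (occ U) (encode-parse w (freeWord-balanced w l c))) c)

theorem2p1 : (n : ℕ) → DoublyRootedPlaneTree n ⤖ FreeDyckPath n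
theorem2p1 n = ↔⇒⤖ (begin
  DoublyRootedPlaneTree n                       ↔⟨ Σ-↔ ↔-refl (×-comm _ _) ⟩
  Σ PlaneTree (λ t → Vertex t × edges t ≡ n)    ↔⟨ Σ-assoc ⟨
  Σ PointedTree (λ p → edges (proj₁ p) ≡ n)     ↔⟨ Σ-weight-↔ zipper↔pointed zipperEdges (λ p → edges (proj₁ p)) edges-plug ⟨
  Σ Zipper (λ z → zipperEdges z ≡ n)            ↔⟨ Σ-weight-↔ runs↔List-⊎ zipperEdges size (uncurry size-join) ⟩
  Σ (List Piece) (λ g → size g ≡ n)             ↔⟨ pieces↔freeWord n ⟩
  FreeWord n                                    ↔⟨ freeDyckPath↔freeWord n ⟨
  FreeDyckPath n                                ∎)
  where open Related.EquationalReasoning
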